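{- Let $G=\prod_{i=1}^n H_i$, where each $H_i$ is a complete multipartite graph. If $S\subseteq V(G)$ is an irredundant set, then there exist sets $L,T\subseteq S$ with $L\cap T=\emptyset$, $L\cup T=S$, $L$ an independent set in $G$, and $|T|\leq 2^n$. (Here $L$ can be taken to be the set of vertices of $S$ having no neighbor in $S$, and $T=S\setminus L$.) In particular, $\mathrm{IR}(G)\leq \alpha(G)+2^n$.
   Context: All graphs are simple. The direct product $\prod_{i=1}^n H_i$ has vertex set $V(H_1)\times\cdots\times V(H_n)$, with $(g_1,\ldots,g_n)$ adjacent to $(g_1',\ldots,g_n')$ iff $g_i$ is adjacent to $g_i'$ in $H_i$ for every $i$. For $S\subseteq V(G)$, $N[S]$ is the union of $S$ with all neighbors of vertices in $S$; $S$ is irredundant if $N[S\setminus\{v\}]\neq N[S]$ for all $v\in S$. $\alpha(G)$ is the independence number and $\mathrm{IR}(G)$ is the maximum size of an irredundant set in $G$. -}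

module Defs where

open import Data.Nat using (ℕ; _≤_; _^_)
open import Data.Fin using (Fin)
open import Data.Vec using (Vec; []; _∷_)
open import Data.Unit using (⊤)
open import Data.Product using (_×_; _,_; ∃; Σ-syntax)
open import Data.Sum using (_⊎_)
open import Data.List using (List; length)
open import Data.List.Membership.Propositional using (_∈_; _∉_)
open import Data.List.Relation.Unary.Unique.Propositional using (Unique)
open import Relation.Binary.PropositionalEquality using (_≡_; _≢_)
open import Relation.Nullary using (¬_)
open import Function.Bundles using (_⇔_)

-- A finite complete multipartite graph: vertex set Fin size, each vertex is
-- assigned a part label; two vertices are adjacent iff their labels differ.
record CMG : Set where
  field
    size : ℕ
    part : Fin size → ℕ
open CMG public

Vtx : ∀ {n} → Vec CMG n → Set
Vtx [] = ⊤
Vtx (H ∷ Hs) = Fin (size H) × Vtx Hs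

Adj : ∀ {n} (Hs : Vec CMG n) → Vtx Hs → Vtx Hs → Set
Adj [] _ _ = ⊤
Adj (H ∷ Hs) (a , x) (b , y) = (part H a ≢ part H b) × Adj Hs x y

InClosedNbhd : ∀ {n} (Hs : Vec CMG n) → (Vtx Hs → Set) → Vtx Hs → Set
InClosedNbhd Hs S w = ∃ λ u → S u × (u ≡ w ⊎ Adj Hs u w)

minus : ∀ {n} {Hs : Vec CMG n} → List (Vtx Hs) → Vtx Hs → Vtx Hs → Set
minus S v u = (u ∈ S) × (u ≢ v)

Irredundant : ∀ {n} (Hs : Vec CMG n) → List (Vtx Hs) → Set
Irredundant Hs S =
  ∀ v → v ∈ S →
    ¬ (∀ w → InClosedNbhd Hs (minus {Hs = Hs} S v) w ⇔ InClosedNbhd Hs (λ u → u ∈ S) w)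

Independent : ∀ {n} (Hs : Vec CMG n) → List (Vtx Hs) → Set
Independent Hs L = ∀ u v → u ∈ L → v ∈ L → ¬ Adj Hs u v

-- By irredundance every v ∈ T has a private neighbour w_v, adjacent to v
-- and to no other vertex of S.  Adjacency of x and y in the product is the non-vanishing of
-- ∏ᵢ (yᵢ − xᵢ) (coordinates read as part labels), and expanding this product writes it as a
-- bilinear form ⟨α x, β y⟩ on ℤ^(2^n).  So the |T| × |T| matrix (⟨α v, β w_u⟩) is diagonal
-- with non-zero diagonal and factors through ℤ^(2^n), whence |T| ≤ 2^n.
module Submission where

open import Defs
import Data.Nat as ℕ
open import Data.Nat using (zero; suc; _≤_; _^_; z≤n; s≤s)
open import Data.Nat.Properties using (m≤n⇒m≤1+n; +-monoʳ-≤; +-suc)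
open import Data.Integer using (0ℤ)
import Data.Fin as Fin
open import Data.Fin using (Fin; zero; suc; punchIn)
open import Data.Fin.Properties using (all?; any?; ¬∀⟶∃¬; punchIn-injective; punchInᵢ≢i)
open import Data.Vec using (Vec; []; _∷_; head; tail; zipWith; map; _++_)
open import Data.Unit using (tt)
open import Data.Product using (_×_; _,_; ∃; ∃₂; proj₁; proj₂)
open import Data.Product.Properties using (≡-dec)
open import Data.Sum using (_⊎_; inj₁; inj₂)
open import Data.List using (List; []; _∷_; length; filter; lookup)
open import Data.List.Membership.Propositional using (_∈_; _∉_)
open import Data.List.Membership.Propositional.Properties using (∈-filter⁺; ∈-filter⁻; ∈-lookup)
open import Data.List.Relation.Unary.Unique.Propositional using (Unique)
import Data.List.Relation.Unary.Unique.Propositional.Properties as Unique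
open import Data.List.Relation.Unary.AllPairs using (_∷_)
import Data.List.Relation.Unary.All as All
open import Data.Empty using (⊥-elim)
open import Function using (_∘_)
open import Function.Bundles using (_⇔_; mk⇔)
open import Relation.Binary.Definitions using (DecidableEquality)
open import Relation.Binary.PropositionalEquality
open import Relation.Nullary using (¬_; Dec; yes; no; ¬?)
open import Relation.Nullary.Decidable using (_×-dec_; _⊎-dec_; map′; decidable-stable)
open import Relation.Unary using (Decidable)
open import Relation.Unary.Properties using (∁?)

module IntegerVectors where

  open import Data.Integer using (ℤ; _+_; _*_; _-_; _≟_)
  open import Data.Integer.Properties using (i*j≡0⇒i≡0∨j≡0; +-identityˡ; +-assoc; *-zeroʳ)
  open import Data.Integer.Tactic.RingSolver using (solve-∀)

  dot : ∀ {m} → Vec ℤ m → Vec ℤ m → ℤ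
  dot [] [] = 0ℤ
  dot (a ∷ u) (b ∷ v) = a * b + dot u v

  dot-empty : (u v : Vec ℤ 0) → dot u v ≡ 0ℤ
  dot-empty [] [] = refl

  combine : ∀ {m} → ℤ → ℤ → Vec ℤ m → Vec ℤ m → Vec ℤ m
  combine c a = zipWith (λ s t → c * s - a * t)

  dot-combine : ∀ {m} c a (u v w : Vec ℤ m) → dot (combine c a u v) w ≡ c * dot u w - a * dot v w
  dot-combine c a [] [] [] = 0≡c*0-a*0 c a
    where
    0≡c*0-a*0 : ∀ c a → 0ℤ ≡ c * 0ℤ - a * 0ℤ
    0≡c*0-a*0 = solve-∀
  dot-combine c a (s ∷ u) (t ∷ v) (r ∷ w) = begin
    (c * s - a * t) * r + dot (combine c a u v) w  ≡⟨ cong ((c * s - a * t) * r +_) (dot-combine c a u v w) ⟩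
    (c * s - a * t) * r + (c * dot u w - a * dot v w) ≡⟨ regroup c a s t r (dot u w) (dot v w) ⟩
    c * (s * r + dot u w) - a * (t * r + dot v w)  ∎
    where
    open ≡-Reasoning
    regroup : ∀ c a s t r d e → (c * s - a * t) * r + (c * d - a * e) ≡ c * (s * r + d) - a * (t * r + e)
    regroup = solve-∀

  scale : ∀ {m} → ℤ → Vec ℤ m → Vec ℤ m
  scale c = map (c *_)

  dot-++ : ∀ {m k} (u v : Vec ℤ m) (u′ v′ : Vec ℤ k) → dot (u ++ u′) (v ++ v′) ≡ dot u v + dot u′ v′
  dot-++ [] [] u′ v′ = sym (+-identityˡ (dot u′ v′))
  dot-++ (a ∷ u) (b ∷ v) u′ v′ = trans (cong (_+_ (a * b)) (dot-++ u v u′ v′)) (sym (+-assoc (a * b) _ _))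

  dot-scaleˡ : ∀ {m} c (u v : Vec ℤ m) → dot (scale c u) v ≡ c * dot u v
  dot-scaleˡ c [] [] = sym (*-zeroʳ c)
  dot-scaleˡ c (a ∷ u) (b ∷ v) = trans (cong (_+_ (c * a * b)) (dot-scaleˡ c u v)) (distrib c a b (dot u v))
    where
    distrib : ∀ c a b d → c * a * b + c * d ≡ c * (a * b + d)
    distrib = solve-∀

  dot-scaleʳ : ∀ {m} c (u v : Vec ℤ m) → dot u (scale c v) ≡ c * dot u v
  dot-scaleʳ c [] [] = sym (*-zeroʳ c)
  dot-scaleʳ c (a ∷ u) (b ∷ v) = trans (cong (_+_ (a * (c * b))) (dot-scaleʳ c u v)) (distrib c a b (dot u v))
    where
    distrib : ∀ c a b d → a * (c * b) + c * d ≡ c * (a * b + d)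
    distrib = solve-∀

  eliminate : ∀ {m} → Vec ℤ (suc m) → Vec ℤ (suc m) → Vec ℤ m
  eliminate (c ∷ u) (a ∷ v) = combine c a v u

  dot-eliminate : ∀ {m} (p x y : Vec ℤ (suc m)) →
    dot (eliminate p x) (tail y) ≡ head p * dot x y - head x * dot p y
  dot-eliminate (c ∷ u) (a ∷ v) (b ∷ w) = begin
    dot (combine c a v u) w                     ≡⟨ dot-combine c a v u w ⟩
    c * dot v w - a * dot u w                   ≡⟨ cancel c a b (dot u w) (dot v w) ⟩
    c * (a * b + dot v w) - a * (c * b + dot u w) ∎
    where
    open ≡-Reasoning
    cancel : ∀ c a b d e → c * e - a * d ≡ c * (a * b + e) - a * (c * b + d)
    cancel = solve-∀

  record Biorthogonal {k m} (A B : Fin k → Vec ℤ m) : Set where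
    field
      off-diagonal : ∀ {j l} → j ≢ l → dot (A j) (B l) ≡ 0ℤ
      diagonal     : ∀ j → dot (A j) (B j) ≢ 0ℤ
  open Biorthogonal

  drop-zero-column : ∀ {k m} {A B : Fin k → Vec ℤ (suc m)} → Biorthogonal A B →
    (∀ j → head (A j) ≡ 0ℤ) → Biorthogonal (tail ∘ A) (tail ∘ B)
  drop-zero-column {A = A} {B} bo zero-column = record
    { off-diagonal = λ j≢l → trans (sym (dot-tail _ _)) (off-diagonal bo j≢l)
    ; diagonal     = λ j eq → diagonal bo j (trans (dot-tail j j) eq)
    }
    where
    dot-tail : ∀ j l → dot (A j) (B l) ≡ dot (tail (A j)) (tail (B l))
    dot-tail j l with A j | B l | zero-column j
    ... | _ ∷ u | _ ∷ w | refl = +-identityˡ (dot u w)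

  eliminate-pivot : ∀ {k m} {A B : Fin (suc k) → Vec ℤ (suc m)} → Biorthogonal A B →
    ∀ p → head (A p) ≢ 0ℤ → Biorthogonal (eliminate (A p) ∘ A ∘ punchIn p) (tail ∘ B ∘ punchIn p)
  eliminate-pivot {A = A} {B} bo p pivot≢0 = record
    { off-diagonal = λ {j} {l} j≢l → begin
        dot (eliminate (A p) (A (punchIn p j))) (tail (B (punchIn p l)))
          ≡⟨ dot-reduced j l ⟩
        c * dot (A (punchIn p j)) (B (punchIn p l))
          ≡⟨ cong (c *_) (off-diagonal bo (j≢l ∘ punchIn-injective p j l)) ⟩
        c * 0ℤ
          ≡⟨ *-zeroʳ c ⟩
        0ℤ ∎
    ; diagonal = λ j → product≢0 pivot≢0 (diagonal bo (punchIn p j)) ∘ trans (sym (dot-reduced j j))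
    }
    where
    open ≡-Reasoning
    c : ℤ
    c = head (A p)
    -- B is orthogonal to the pivot row, so eliminating only rescales each pairing by c.
    dot-reduced : ∀ j l → dot (eliminate (A p) (A (punchIn p j))) (tail (B (punchIn p l)))
                          ≡ c * dot (A (punchIn p j)) (B (punchIn p l))
    dot-reduced j l = begin
      dot (eliminate (A p) (A j′)) (tail (B l′))
        ≡⟨ dot-eliminate (A p) (A j′) (B l′) ⟩
      c * dot (A j′) (B l′) - head (A j′) * dot (A p) (B l′)
        ≡⟨ cong (λ t → c * dot (A j′) (B l′) - head (A j′) * t) (off-diagonal bo (punchInᵢ≢i p l ∘ sym)) ⟩
      c * dot (A j′) (B l′) - head (A j′) * 0ℤ
        ≡⟨ x-a*0≡x (c * dot (A j′) (B l′)) (head (A j′)) ⟩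
      c * dot (A j′) (B l′) ∎
      where
      j′ l′ : Fin (suc _)
      j′ = punchIn p j
      l′ = punchIn p l
      x-a*0≡x : ∀ x a → x - a * 0ℤ ≡ x
      x-a*0≡x = solve-∀
    product≢0 : ∀ {a b} → a ≢ 0ℤ → b ≢ 0ℤ → a * b ≢ 0ℤ
    product≢0 {a} a≢0 b≢0 ab≡0 with i*j≡0⇒i≡0∨j≡0 a ab≡0
    ... | inj₁ a≡0 = a≢0 a≡0
    ... | inj₂ b≡0 = b≢0 b≡0

  biorthogonal⇒≤ : ∀ {k m} {A B : Fin k → Vec ℤ m} → Biorthogonal A B → k ≤ m
  biorthogonal⇒≤ {zero} _ = z≤n
  biorthogonal⇒≤ {suc k} {zero} {A} {B} bo = ⊥-elim (diagonal bo zero (dot-empty (A zero) (B zero)))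
  biorthogonal⇒≤ {suc k} {suc m} {A} bo with all? (λ j → head (A j) ≟ 0ℤ)
  ... | yes zero-column = m≤n⇒m≤1+n (biorthogonal⇒≤ (drop-zero-column bo zero-column))
  ... | no ¬zero-column with ¬∀⟶∃¬ (suc k) _ (λ j → head (A j) ≟ 0ℤ) ¬zero-column
  ...   | p , pivot≢0 = s≤s (biorthogonal⇒≤ (eliminate-pivot bo p pivot≢0))

open IntegerVectors

module LabelGaps where

  open import Data.Integer using (ℤ; 1ℤ; +_; -_; _+_; _*_; _-_)
  open import Data.Integer.Properties
    using (*-zeroʳ; +-identityʳ; i≡j⇒i-j≡0; i-j≡0⇒i≡j; +-injective; i*j≡0⇒i≡0∨j≡0)
  open import Data.Integer.Tactic.RingSolver using (solve-∀)
  open import Data.Nat.Properties using (_≟_)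

  label : (H : CMG) → Fin (size H) → ℤ
  label H a = + part H a

  gapProduct : ∀ {n} (Hs : Vec CMG n) → Vtx Hs → Vtx Hs → ℤ
  gapProduct [] _ _ = 1ℤ
  gapProduct (H ∷ Hs) (a , x) (b , y) = (label H b - label H a) * gapProduct Hs x y

  adj⇒gapProduct≢0 : ∀ {n} (Hs : Vec CMG n) x y → Adj Hs x y → gapProduct Hs x y ≢ 0ℤ
  adj⇒gapProduct≢0 [] _ _ _ ()
  adj⇒gapProduct≢0 (H ∷ Hs) (a , x) (b , y) (a≁b , x~y) product≡0
    with i*j≡0⇒i≡0∨j≡0 (label H b - label H a) product≡0
  ... | inj₁ gap≡0 = a≁b (sym (+-injective (i-j≡0⇒i≡j _ _ gap≡0)))
  ... | inj₂ rest≡0 = adj⇒gapProduct≢0 Hs x y x~y rest≡0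

  ¬adj⇒gapProduct≡0 : ∀ {n} (Hs : Vec CMG n) x y → ¬ Adj Hs x y → gapProduct Hs x y ≡ 0ℤ
  ¬adj⇒gapProduct≡0 [] _ _ ¬x~y = ⊥-elim (¬x~y tt)
  ¬adj⇒gapProduct≡0 (H ∷ Hs) (a , x) (b , y) ¬x~y with part H a ≟ part H b
  ... | yes a≈b = cong (_* gapProduct Hs x y) (i≡j⇒i-j≡0 (cong +_ (sym a≈b)))
  ... | no a≁b = trans (cong ((label H b - label H a) *_) (¬adj⇒gapProduct≡0 Hs x y (¬x~y ∘ (a≁b ,_))))
                       (*-zeroʳ (label H b - label H a))

  -- Expanding ∏ᵢ (bᵢ − aᵢ): each factor contributes −aᵢ·1 + 1·bᵢ, so the product is a sum of
  -- 2^n terms, each a monomial in the a's times a monomial in the b's.  The trailing ++ []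
  -- matches the unfolding 2 ^ suc n = 2 ^ n + (2 ^ n + 0).
  leftFactor : ∀ {n} (Hs : Vec CMG n) → Vtx Hs → Vec ℤ (2 ^ n)
  leftFactor [] _ = 1ℤ ∷ []
  leftFactor (H ∷ Hs) (a , x) = scale (- label H a) (leftFactor Hs x) ++ leftFactor Hs x ++ []

  rightFactor : ∀ {n} (Hs : Vec CMG n) → Vtx Hs → Vec ℤ (2 ^ n)
  rightFactor [] _ = 1ℤ ∷ []
  rightFactor (H ∷ Hs) (b , y) = rightFactor Hs y ++ scale (label H b) (rightFactor Hs y) ++ []

  dot-factors≡gapProduct : ∀ {n} (Hs : Vec CMG n) x y →
    dot (leftFactor Hs x) (rightFactor Hs y) ≡ gapProduct Hs x y
  dot-factors≡gapProduct [] _ _ = refl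
  dot-factors≡gapProduct {suc n} (H ∷ Hs) (a , x) (b , y) = begin
    dot (scale (- label H a) αx ++ αx ++ []) (βy ++ scale (label H b) βy ++ [])
      ≡⟨ dot-++ (scale (- label H a) αx) βy _ _ ⟩
    dot (scale (- label H a) αx) βy + dot (αx ++ []) (scale (label H b) βy ++ [])
      ≡⟨ cong (_+_ (dot (scale (- label H a) αx) βy)) (trans (dot-++ αx _ [] []) (+-identityʳ _)) ⟩
    dot (scale (- label H a) αx) βy + dot αx (scale (label H b) βy)
      ≡⟨ cong₂ _+_ (dot-scaleˡ (- label H a) αx βy) (dot-scaleʳ (label H b) αx βy) ⟩
    - label H a * dot αx βy + label H b * dot αx βy
      ≡⟨ factor (label H a) (label H b) (dot αx βy) ⟩
    (label H b - label H a) * dot αx βy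
      ≡⟨ cong ((label H b - label H a) *_) (dot-factors≡gapProduct Hs x y) ⟩
    (label H b - label H a) * gapProduct Hs x y ∎
    where
    open ≡-Reasoning
    αx βy : Vec ℤ (2 ^ n)
    αx = leftFactor Hs x
    βy = rightFactor Hs y
    factor : ∀ a b d → - a * d + b * d ≡ (b - a) * d
    factor = solve-∀

open LabelGaps
open import Data.Nat using (_+_)

module FilterPartition {A : Set} {P : A → Set} (P? : Decidable P) where

  ∈-filter⇔ : ∀ {x xs} → (x ∈ filter P? xs) ⇔ (x ∈ xs × P x)
  ∈-filter⇔ {xs = xs} = mk⇔ (∈-filter⁻ P? {xs = xs}) (λ (x∈xs , px) → ∈-filter⁺ P? x∈xs px)

  ∈⇔∈-filter⊎∈-filter∁ : ∀ {x xs} → (x ∈ xs) ⇔ (x ∈ filter P? xs ⊎ x ∈ filter (∁? P?) xs)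
  ∈⇔∈-filter⊎∈-filter∁ {x} = mk⇔ to from
    where
    to : ∀ {xs} → x ∈ xs → x ∈ filter P? xs ⊎ x ∈ filter (∁? P?) xs
    to x∈xs with P? x
    ... | yes px = inj₁ (∈-filter⁺ P? x∈xs px)
    ... | no ¬px = inj₂ (∈-filter⁺ (∁? P?) x∈xs ¬px)
    from : ∀ {xs} → x ∈ filter P? xs ⊎ x ∈ filter (∁? P?) xs → x ∈ xs
    from {xs} (inj₁ x∈) = proj₁ (∈-filter⁻ P? {xs = xs} x∈)
    from {xs} (inj₂ x∈) = proj₁ (∈-filter⁻ (∁? P?) {xs = xs} x∈)

  filter-disjoint : ∀ {x xs} → x ∈ filter P? xs → x ∉ filter (∁? P?) xs
  filter-disjoint {xs = xs} x∈ x∈∁ =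
    proj₂ (∈-filter⁻ (∁? P?) {xs = xs} x∈∁) (proj₂ (∈-filter⁻ P? {xs = xs} x∈))

  length≡filter+filter∁ : ∀ xs → length xs ≡ length (filter P? xs) + length (filter (∁? P?) xs)
  length≡filter+filter∁ [] = refl
  length≡filter+filter∁ (x ∷ xs) with P? x
  ... | yes _ = cong suc (length≡filter+filter∁ xs)
  ... | no _ = trans (cong suc (length≡filter+filter∁ xs)) (sym (+-suc _ _))

open FilterPartition

lookup-injective : ∀ {A : Set} {xs : List A} → Unique xs → ∀ {i j} → lookup xs i ≡ lookup xs j → i ≡ j
lookup-injective (_ ∷ _) {zero} {zero} _ = refl
lookup-injective (x∉ ∷ _) {zero} {suc j} eq = ⊥-elim (All.lookup x∉ (∈-lookup j) eq)
lookup-injective (x∉ ∷ _) {suc i} {zero} eq = ⊥-elim (All.lookup x∉ (∈-lookup i) (sym eq))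
lookup-injective (_ ∷ unique) {suc i} {suc j} eq = cong suc (lookup-injective unique eq)

vertex-≟ : ∀ {n} {Hs : Vec CMG n} → DecidableEquality (Vtx Hs)
vertex-≟ {Hs = []} tt tt = yes refl
vertex-≟ {Hs = H ∷ Hs} = ≡-dec Fin._≟_ vertex-≟

adj? : ∀ {n} (Hs : Vec CMG n) x y → Dec (Adj Hs x y)
adj? [] _ _ = yes tt
adj? (H ∷ Hs) (a , x) (b , y) = ¬? (part H a ℕ.≟ part H b) ×-dec adj? Hs x y

adj-sym : ∀ {n} (Hs : Vec CMG n) {x y} → Adj Hs x y → Adj Hs y x
adj-sym [] _ = tt
adj-sym (H ∷ Hs) (a≁b , x~y) = a≁b ∘ sym , adj-sym Hs x~y

adj-irrefl : ∀ {n} (Hs : Vec CMG (suc n)) x → ¬ Adj Hs x x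
adj-irrefl (H ∷ Hs) (a , x) (a≁a , _) = a≁a refl

any-vertex? : ∀ {n} (Hs : Vec CMG n) {P : Vtx Hs → Set} → Decidable P → Dec (∃ P)
any-vertex? [] P? = map′ (tt ,_) proj₂ (P? tt)
any-vertex? (H ∷ Hs) P? =
  map′ (λ (a , x , px) → (a , x) , px) (λ ((a , x) , px) → a , x , px)
       (any? λ a → any-vertex? Hs (λ x → P? (a , x)))

closedNbhd? : ∀ {n} (Hs : Vec CMG n) {S : Vtx Hs → Set} → Decidable S → Decidable (InClosedNbhd Hs S)
closedNbhd? Hs S? w = any-vertex? Hs (λ u → S? u ×-dec (vertex-≟ u w ⊎-dec adj? Hs u w))

privateNeighbours⇒length≤2^n : ∀ {n} (Hs : Vec CMG n) {T : List (Vtx Hs)} → Unique T →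
  (∀ {v} → v ∈ T → ∃ λ w → Adj Hs v w × (∀ {s} → s ∈ T → s ≢ v → ¬ Adj Hs s w)) →
  length T ≤ 2 ^ n
privateNeighbours⇒length≤2^n Hs {T} unique privateNbr =
  biorthogonal⇒≤ {A = leftFactor Hs ∘ lookup T} {B = rightFactor Hs ∘ neighbour} record
    { off-diagonal = λ {j} {l} j≢l → trans (dot-factors≡gapProduct Hs _ _)
        (¬adj⇒gapProduct≡0 Hs _ _ (exclusive l (∈-lookup j) (j≢l ∘ lookup-injective unique)))
    ; diagonal = λ j → adj⇒gapProduct≢0 Hs _ _ (adjacent j) ∘ trans (sym (dot-factors≡gapProduct Hs _ _))
    }
  where
  neighbour : Fin (length T) → Vtx Hs
  neighbour j = proj₁ (privateNbr (∈-lookup j))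
  adjacent : ∀ j → Adj Hs (lookup T j) (neighbour j)
  adjacent j = proj₁ (proj₂ (privateNbr (∈-lookup j)))
  exclusive : ∀ j {s} → s ∈ T → s ≢ lookup T j → ¬ Adj Hs s (neighbour j)
  exclusive j = proj₂ (proj₂ (privateNbr (∈-lookup j)))

module Domination {n} (Hs : Vec CMG n) (S : List (Vtx Hs)) where

  open import Data.List.Membership.DecPropositional (vertex-≟ {Hs = Hs}) using (_∈?_)

  dominated? : Decidable (InClosedNbhd Hs (_∈ S))
  dominated? = closedNbhd? Hs (_∈? S)

  dominatedWithout? : ∀ v → Decidable (InClosedNbhd Hs (minus {Hs = Hs} S v))
  dominatedWithout? v = closedNbhd? Hs (λ u → (u ∈? S) ×-dec ¬? (vertex-≟ u v))

  -- Irredundance only refutes N[S ∖ {v}] = N[S]; a witness is found by exhaustive search.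
  privateNeighbour : Irredundant Hs S → ∀ {v} → v ∈ S →
    ∃ λ w → InClosedNbhd Hs (_∈ S) w × ¬ InClosedNbhd Hs (minus {Hs = Hs} S v) w
  privateNeighbour irr {v} v∈S with any-vertex? Hs (λ w → dominated? w ×-dec ¬? (dominatedWithout? v w))
  ... | yes found = found
  ... | no none = ⊥-elim (irr v v∈S λ w → mk⇔
        (λ (u , (u∈S , _) , u≈w) → u , u∈S , u≈w)
        (λ w∈N → decidable-stable (dominatedWithout? v w) λ w∉N′ → none (w , w∈N , w∉N′)))

  Isolated : Vtx Hs → Set
  Isolated v = ∀ u → u ∈ S → ¬ Adj Hs v u

  isolated? : Decidable Isolated
  isolated? v = map′ (λ all _ → All.lookup all) (λ iso → All.tabulate (iso _))
                     (All.all? (λ u → ¬? (adj? Hs v u)) S)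

  isolated nonIsolated : List (Vtx Hs)
  isolated = filter isolated? S
  nonIsolated = filter (∁? isolated?) S

  isolated-independent : Independent Hs isolated
  isolated-independent u v u∈L v∈L =
    proj₂ (∈-filter⁻ isolated? {xs = S} u∈L) v (proj₁ (∈-filter⁻ isolated? {xs = S} v∈L))

  -- The private neighbour w of v cannot be v itself: a neighbour of v in S would dominate it.
  nonIsolated⇒privateNeighbour : (∀ x → ¬ Adj Hs x x) → Irredundant Hs S →
    ∀ {v} → v ∈ S → ¬ Isolated v →
    ∃ λ w → Adj Hs v w × (∀ {s} → s ∈ S → s ≢ v → ¬ Adj Hs s w)
  nonIsolated⇒privateNeighbour irrefl irr {v} v∈S ¬isolated with privateNeighbour irr v∈S
  ... | w , (u , u∈S , u≈w) , w∉N′ with vertex-≟ u v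
  ...   | no u≢v = ⊥-elim (w∉N′ (u , (u∈S , u≢v) , u≈w))
  ...   | yes refl with u≈w
  ...     | inj₂ v~w = w , v~w , λ s∈S s≢v s~w → w∉N′ (_ , (s∈S , s≢v) , inj₂ s~w)
  ...     | inj₁ refl = ⊥-elim (¬isolated λ u′ u′∈S v~u′ →
              w∉N′ (u′ , (u′∈S , λ { refl → irrefl u′ v~u′ }) , inj₂ (adj-sym Hs v~u′)))

  nonIsolated-length≤2^n : (∀ x → ¬ Adj Hs x x) → Unique S → Irredundant Hs S →
    length nonIsolated ≤ 2 ^ n
  nonIsolated-length≤2^n irrefl unique irr =
    privateNeighbours⇒length≤2^n Hs (Unique.filter⁺ (∁? isolated?) unique) λ v∈T →
      let v∈S , ¬isolated = ∈-filter⁻ (∁? isolated?) {xs = S} v∈T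
          w , v~w , exclusive = nonIsolated⇒privateNeighbour irrefl irr v∈S ¬isolated
      in w , v~w , λ s∈T → exclusive (proj₁ (∈-filter⁻ (∁? isolated?) {xs = S} s∈T))

  length≤isolated+2^n : (∀ x → ¬ Adj Hs x x) → Unique S → Irredundant Hs S →
    length S ≤ length isolated + 2 ^ n
  length≤isolated+2^n irrefl unique irr =
    subst (_≤ length isolated + 2 ^ n) (sym (length≡filter+filter∁ isolated? S))
          (+-monoʳ-≤ (length isolated) (nonIsolated-length≤2^n irrefl unique irr))

theorem1p4 : ∀ {n} → 1 ≤ n → (Hs : Vec CMG n) →
    ((S : List (Vtx Hs)) → Unique S → Irredundant Hs S →
      ∃₂ λ (L T : List (Vtx Hs)) →
        Unique L × Unique T ×
        (∀ v → v ∈ L → v ∉ T) ×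
        (∀ v → (v ∈ S) ⇔ (v ∈ L ⊎ v ∈ T)) ×
        Independent Hs L ×
        length T ≤ 2 ^ n ×
        (∀ v → (v ∈ L) ⇔ ((v ∈ S) × (∀ u → u ∈ S → ¬ Adj Hs v u))))
    ×
    ((S : List (Vtx Hs)) → Unique S → Irredundant Hs S →
      ∃ λ (I : List (Vtx Hs)) → Unique I × Independent Hs I × length S ≤ length I + 2 ^ n)
theorem1p4 {suc n} _ Hs =
  (λ S unique irr → let open Domination Hs S in
    isolated , nonIsolated ,
    Unique.filter⁺ isolated? unique , Unique.filter⁺ (∁? isolated?) unique ,
    (λ _ → filter-disjoint isolated? {xs = S}) , (λ _ → ∈⇔∈-filter⊎∈-filter∁ isolated? {xs = S}) ,
    isolated-independent , nonIsolated-length≤2^n (adj-irrefl Hs) unique irr ,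
    (λ _ → ∈-filter⇔ isolated? {xs = S}))
  ,
  (λ S unique irr → let open Domination Hs S in
    isolated , Unique.filter⁺ isolated? unique , isolated-independent ,
    length≤isolated+2^n (adj-irrefl Hs) unique irr)
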